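{- Let $\Bbbk$ be a field of characteristic zero, $N$ a positive integer, $M=\bigoplus_{k\in\frac{1}{N}\mathbb{Z}}M_k$ a graded algebra of type $\frac{1}{N}\mathbb{Z}$ over $\Bbbk$, $\partial$ a derivation of $M$ of degree $2$, and $\mathcal{E}_4\in M_4$. Let $\widetilde{M}=M[\mathcal{E}_2]$ be the polynomial ring in an indeterminate $\mathcal{E}_2$ of degree $2$, and extend $\partial$ to a derivation of $\widetilde{M}$ by $\partial\mathcal{E}_2:=\mathcal{E}_4-\mathcal{E}_2^2$. Define $\partial_{(0)}\mathcal{E}_2:=\mathcal{E}_2$, $\partial_{(1)}\mathcal{E}_2:=\partial\mathcal{E}_2=\mathcal{E}_4-\mathcal{E}_2^2$, and $\partial_{(j+1)}\mathcal{E}_2:=\partial(\partial_{(j)}\mathcal{E}_2)+j(j+1)\mathcal{E}_4\,\partial_{(j-1)}\mathcal{E}_2$ for $j\ge1$. Define $\Psi_0:=0$, $\Psi_1:=\mathcal{E}_4$, and $\Psi_{j+1}:=\partial\Psi_j+j(j+1)\mathcal{E}_4\Psi_{j-1}$ for $j\ge1$. Then for every integer $n\ge0$, $\Psi_n$ is a polynomial in $\mathcal{E}_4,\partial\mathcal{E}_4,\ldots,\partial^{n-1}\mathcal{E}_4$, $$\partial_{(n)}\mathcal{E}_2=\Psi_n+(-1)^n n!\,\mathcal{E}_2^{\,n+1},$$ and in particular $\Psi_n=\partial_{(n)}\mathcal{E}_2+(-1)^{n+1}n!\,\mathcal{E}_2^{\,n+1}\in M_{2n+2}$.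
   Context: A graded algebra of type $\frac{1}{N}\mathbb{Z}$ over $\Bbbk$ is a commutative, associative $\Bbbk$-algebra with unit $M=\bigoplus_{k\in\frac{1}{N}\mathbb{Z}}M_k$ with $M_kM_l\subseteq M_{k+l}$, $1\in M_0$, $\dim_\Bbbk M_k<\infty$. A degree-$2$ derivation maps $M_k$ into $M_{k+2}$; $\partial^j$ is the $j$-th iterate. -}

module Defs where

open import Level using (Level; _⊔_) renaming (suc to lsuc)
open import Algebra.Bundles using (CommutativeRing)
open import Algebra.Morphism.Structures using (module RingMorphisms)
open import Data.Nat as ℕ using (ℕ; zero; suc)
open import Data.Nat using (_!)
open import Data.Integer as ℤ using (ℤ)
open import Data.List using (List; []; _∷_; map; upTo)
open import Data.List.Membership.Propositional using (_∈_)
open import Data.List.Relation.Unary.All using (All)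
open import Data.List.Relation.Unary.Unique.Propositional using (Unique)
open import Data.Product using (_×_; _,_; proj₁; proj₂; ∃)
open import Data.Unit.Polymorphic using (⊤)
open import Relation.Nullary using (¬_)

private
  variable
    k kℓ m mℓ h : Level

module RingHelpers {c ℓ} (R : CommutativeRing c ℓ) where
  open CommutativeRing R

  _·ℕ_ : ℕ → Carrier → Carrier
  zero  ·ℕ x = 0#
  suc n ·ℕ x = x + (n ·ℕ x)

  negPow : ℕ → Carrier
  negPow zero    = 1#
  negPow (suc n) = - negPow n

  sumL : List Carrier → Carrier
  sumL []       = 0#
  sumL (x ∷ xs) = x + sumL xs

record IsField (K : CommutativeRing k kℓ) : Set (k ⊔ kℓ) where
  open CommutativeRing K
  field
    1≉0     : ¬ (1# ≈ 0#)
    inverse : ∀ x → ¬ (x ≈ 0#) → ∃ λ y → (x * y) ≈ 1#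

CharZero : CommutativeRing k kℓ → Set kℓ
CharZero K = ∀ n → ¬ ((suc n ·ℕ 1#) ≈ 0#)
  where open CommutativeRing K
        open RingHelpers K

record CommAlgebra (K : CommutativeRing k kℓ) m mℓ : Set (k ⊔ kℓ ⊔ lsuc (m ⊔ mℓ)) where
  field
    baseRing : CommutativeRing m mℓ
  open CommutativeRing baseRing public
  private module K = CommutativeRing K
  field
    ι     : K.Carrier → Carrier
    ι-hom : RingMorphisms.IsRingHomomorphism K.rawRing rawRing ι
  _•_ : K.Carrier → Carrier → Carrier
  c • x = ι c * x
  open RingHelpers baseRing public

-- Gradings of type (1/N)ℤ.  The index i : ℤ stands for the degree i/N,
-- so  Hom i x  means  x ∈ M_{i/N}.

record Grading {K : CommutativeRing k kℓ} (A : CommAlgebra K m mℓ) h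
       : Set (k ⊔ kℓ ⊔ m ⊔ mℓ ⊔ lsuc h) where
  open CommAlgebra A
  private module K = CommutativeRing K
  field
    Hom      : ℤ → Carrier → Set h
    Hom-resp : ∀ {i x y} → x ≈ y → Hom i x → Hom i y
    Hom-0    : ∀ {i} → Hom i 0#
    Hom-+    : ∀ {i x y} → Hom i x → Hom i y → Hom i (x + y)
    Hom-•    : ∀ {i x} (c : K.Carrier) → Hom i x → Hom i (c • x)
    Hom-*    : ∀ {i j x y} → Hom i x → Hom j y → Hom (i ℤ.+ j) (x * y)
    Hom-1    : Hom (ℤ.+ 0) 1#
    decomp   : ∀ x → ∃ λ (cs : List (ℤ × Carrier)) →
                 Unique (map proj₁ cs) ×
                 All (λ p → Hom (proj₁ p) (proj₂ p)) cs ×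
                 (x ≈ sumL (map proj₂ cs))
    indep    : ∀ (cs : List (ℤ × Carrier)) →
                 Unique (map proj₁ cs) →
                 All (λ p → Hom (proj₁ p) (proj₂ p)) cs →
                 sumL (map proj₂ cs) ≈ 0# →
                 All (λ p → proj₂ p ≈ 0#) cs
    finDim   : ∀ i → ∃ λ (B : List Carrier) →
                 All (Hom i) B ×
                 (∀ x → Hom i x →
                    ∃ λ (ps : List (K.Carrier × Carrier)) →
                      All (λ p → proj₂ p ∈ B) ps ×
                      (x ≈ sumL (map (λ p → proj₁ p • proj₂ p) ps)))

-- K-linear derivations of degree 2 for a grading of type (1/N)ℤ
-- (degree 2 = index shift by 2N)

record IsDerivation2 {K : CommutativeRing k kℓ} {A : CommAlgebra K m mℓ}
       (N : ℕ) (G : Grading A h) (∂ : CommAlgebra.Carrier A → CommAlgebra.Carrier A)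
       : Set (k ⊔ kℓ ⊔ m ⊔ mℓ ⊔ h) where
  open CommAlgebra A
  open Grading G
  private module K = CommutativeRing K
  field
    ∂-cong   : ∀ {x y} → x ≈ y → ∂ x ≈ ∂ y
    ∂-+      : ∀ x y → ∂ (x + y) ≈ ∂ x + ∂ y
    ∂-•      : ∀ (c : K.Carrier) x → ∂ (c • x) ≈ c • ∂ x
    leibniz  : ∀ x y → ∂ (x * y) ≈ (∂ x * y) + (x * ∂ y)
    ∂-degree : ∀ {i x} → Hom i x → Hom (i ℤ.+ ℤ.+ (2 ℕ.* N)) (∂ x)

-- The polynomial ring  M̃ = M[E₂]  as coefficient lists (constant term
-- first), equality up to trailing zeros, and the constructions of §6.

module Constructions {K : CommutativeRing k kℓ} (A : CommAlgebra K m mℓ)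
       (∂ : CommAlgebra.Carrier A → CommAlgebra.Carrier A)
       (E₄ : CommAlgebra.Carrier A) where
  open CommAlgebra A

  Poly : Set m
  Poly = List Carrier

  infix 4 _≈ₚ_
  _≈ₚ_ : Poly → Poly → Set mℓ
  []       ≈ₚ []       = ⊤
  []       ≈ₚ (b ∷ q)  = (b ≈ 0#) × ([] ≈ₚ q)
  (a ∷ p)  ≈ₚ []       = (a ≈ 0#) × (p ≈ₚ [])
  (a ∷ p)  ≈ₚ (b ∷ q)  = (a ≈ b) × (p ≈ₚ q)

  infixl 6 _+ₚ_
  _+ₚ_ : Poly → Poly → Poly
  []      +ₚ q       = q
  (a ∷ p) +ₚ []      = a ∷ p
  (a ∷ p) +ₚ (b ∷ q) = (a + b) ∷ (p +ₚ q)

  -ₚ_ : Poly → Poly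
  -ₚ p = map -_ p

  scaleₚ : Carrier → Poly → Poly
  scaleₚ a p = map (a *_) p

  infixl 7 _*ₚ_
  _*ₚ_ : Poly → Poly → Poly
  []      *ₚ q = []
  (a ∷ p) *ₚ q = scaleₚ a q +ₚ (0# ∷ (p *ₚ q))

  const : Carrier → Poly
  const a = a ∷ []

  E₂ : Poly
  E₂ = 0# ∷ 1# ∷ []

  _^ₚ_ : Poly → ℕ → Poly
  p ^ₚ zero  = const 1#
  p ^ₚ suc n = p *ₚ (p ^ₚ n)

  derivFrom : ℕ → Poly → Poly
  derivFrom j []      = []
  derivFrom j (a ∷ p) = (j ·ℕ a) ∷ derivFrom (suc j) p

  formalDeriv : Poly → Poly
  formalDeriv []      = []
  formalDeriv (a ∷ p) = derivFrom 1 p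

  -- the (unique) extension of ∂ to a derivation of M̃ with ∂E₂ = E₄ − E₂²:
  --   ∂̃ (Σ aᵢ E₂ⁱ) = Σ (∂aᵢ) E₂ⁱ + (Σ i aᵢ E₂ⁱ⁻¹)(E₄ − E₂²)
  ∂̃ : Poly → Poly
  ∂̃ p = map ∂ p +ₚ (formalDeriv p *ₚ (const E₄ +ₚ (-ₚ (E₂ *ₚ E₂))))

  ∂₍₎E₂-pair : ℕ → Poly × Poly
  ∂₍₎E₂-pair zero    = E₂ , ∂̃ E₂
  ∂₍₎E₂-pair (suc n) with ∂₍₎E₂-pair n
  ... | a , b = b , (∂̃ b +ₚ scaleₚ ((suc n ℕ.* suc (suc n)) ·ℕ E₄) a)

  ∂₍_₎E₂ : ℕ → Poly
  ∂₍ n ₎E₂ = proj₁ (∂₍₎E₂-pair n)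

  Ψ-pair : ℕ → Carrier × Carrier
  Ψ-pair zero    = 0# , E₄
  Ψ-pair (suc n) with Ψ-pair n
  ... | a , b = b , (∂ b + ((suc n ℕ.* suc (suc n)) ·ℕ (E₄ * a)))

  Ψ : ℕ → Carrier
  Ψ n = proj₁ (Ψ-pair n)

  ∂^_E₄ : ℕ → Carrier
  ∂^ zero  E₄ = E₄
  ∂^ suc j E₄ = ∂ (∂^ j E₄)

  signFact : ℕ → ℕ → Carrier
  signFact s n = negPow s * ((n !) ·ℕ 1#)

  data PolyIn (gens : List Carrier) : Carrier → Set (k ⊔ m ⊔ mℓ) where
    scalar : ∀ c → PolyIn gens (ι c)
    gen    : ∀ {x} → x ∈ gens → PolyIn gens x
    add    : ∀ {x y} → PolyIn gens x → PolyIn gens y → PolyIn gens (x + y)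
    mul    : ∀ {x y} → PolyIn gens x → PolyIn gens y → PolyIn gens (x * y)
    resp   : ∀ {x y} → x ≈ y → PolyIn gens x → PolyIn gens y

  E₄-derivs : ℕ → List Carrier
  E₄-derivs n = map ∂^_E₄ (upTo n)

-- Polynomials in E₂ are compared coefficientwise.  The shape
-- ∂₍ₙ₎E₂ = Ψₙ + cₙ E₂ⁿ⁺¹ with cₙ = (−1)ⁿ n! is preserved by the recursion:
-- for ∂c = 0, ∂̃ maps a + c E₂ᵈ⁺¹ to ∂a + (d+1) c E₄ E₂ᵈ − (d+1) c E₂ᵈ⁺², so in
-- ∂̃(∂₍ₙ₊₁₎E₂) + (n+1)(n+2) E₄ ∂₍ₙ₎E₂ the E₄ E₂ⁿ⁺¹ terms cancel because
-- cₙ₊₁ = −(n+1) cₙ, the top term is −(n+2) cₙ₊₁ E₂ⁿ⁺³ = cₙ₊₂ E₂ⁿ⁺³, and the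
-- constant term follows the recursion defining Ψ.  Read directly, that recursion
-- also shows that Ψₙ is a polynomial in E₄, …, ∂ⁿ⁻¹E₄, homogeneous of degree 2n + 2.
module Submission where

open import Defs
open import Algebra.Bundles using (CommutativeRing)
open import Algebra.Morphism.Structures using (module RingMorphisms)
open import Data.Nat as ℕ using (ℕ; zero; suc; _<_; _!; s≤s; z≤n)
import Data.Nat.Properties as ℕₚ
open import Data.Nat.Tactic.RingSolver using (solve-∀)
import Data.Integer as ℤ
open import Data.List using ([]; _∷_; map)
open import Data.List.Membership.Propositional using (_∈_)
open import Data.List.Membership.Propositional.Properties using (∈-map⁺; ∈-map⁻; ∈-upTo⁺; ∈-upTo⁻)
open import Data.List.Relation.Binary.Subset.Propositional using (_⊆_)
open import Data.Product using (_×_; _,_)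
open import Relation.Binary.PropositionalEquality as ≡ using (_≡_)

module NatMultiples {c ℓ} (R : CommutativeRing c ℓ) where
  open CommutativeRing R hiding (zero)
  open RingHelpers R using (_·ℕ_)
  open import Algebra.Properties.Semiring.Mult semiring using (×-congʳ; ×-assoc-*; ×1-homo-*)
    renaming (_×_ to _×ₘ_)

  ·ℕ≡× : ∀ n x → n ·ℕ x ≡ n ×ₘ x
  ·ℕ≡× zero    x = ≡.refl
  ·ℕ≡× (suc n) x = ≡.cong (x +_) (·ℕ≡× n x)

  ·ℕ-congʳ : ∀ n {x y} → x ≈ y → n ·ℕ x ≈ n ·ℕ y
  ·ℕ-congʳ n {x} {y} x≈y rewrite ·ℕ≡× n x | ·ℕ≡× n y = ×-congʳ n x≈y

  ·ℕ-zeroʳ : ∀ n → n ·ℕ 0# ≈ 0#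
  ·ℕ-zeroʳ zero    = refl
  ·ℕ-zeroʳ (suc n) = trans (+-identityˡ _) (·ℕ-zeroʳ n)

  ·ℕ-assoc-* : ∀ n x y → (n ·ℕ x) * y ≈ n ·ℕ (x * y)
  ·ℕ-assoc-* n x y rewrite ·ℕ≡× n x | ·ℕ≡× n (x * y) = ×-assoc-* n x y

  ·ℕ-as-* : ∀ n x → n ·ℕ x ≈ (n ·ℕ 1#) * x
  ·ℕ-as-* n x = sym (trans (·ℕ-assoc-* n 1# x) (·ℕ-congʳ n (*-identityˡ x)))

  ·ℕ1-homo-* : ∀ m n → (m ℕ.* n) ·ℕ 1# ≈ (m ·ℕ 1#) * (n ·ℕ 1#)
  ·ℕ1-homo-* m n rewrite ·ℕ≡× (m ℕ.* n) 1# | ·ℕ≡× m 1# | ·ℕ≡× n 1# = ×1-homo-* m n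

module Sequences {c ℓ} (R : CommutativeRing c ℓ) where
  open CommutativeRing R hiding (zero)

  infix 4 _≋_
  _≋_ : (ℕ → Carrier) → (ℕ → Carrier) → Set ℓ
  f ≋ g = ∀ i → f i ≈ g i

  infixl 6 _⊕_
  _⊕_ : (ℕ → Carrier) → (ℕ → Carrier) → ℕ → Carrier
  (f ⊕ g) i = f i + g i

  shift : (ℕ → Carrier) → ℕ → Carrier
  shift f zero    = 0#
  shift f (suc i) = f i

  monomial : ℕ → Carrier → ℕ → Carrier
  monomial zero    c zero    = c
  monomial zero    c (suc i) = 0#
  monomial (suc d) c i       = shift (monomial d c) i

  binomial : Carrier → ℕ → Carrier → ℕ → Carrier
  binomial a d c = monomial 0 a ⊕ monomial (suc d) c

  shift-cong : ∀ {f g} → f ≋ g → shift f ≋ shift g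
  shift-cong f≋g zero    = refl
  shift-cong f≋g (suc i) = f≋g i

  monomial-cong : ∀ d {a b} → a ≈ b → monomial d a ≋ monomial d b
  monomial-cong zero    a≈b zero    = a≈b
  monomial-cong zero    a≈b (suc i) = refl
  monomial-cong (suc d) a≈b         = shift-cong (monomial-cong d a≈b)

  monomial-zero : ∀ d {c} → c ≈ 0# → ∀ i → monomial d c i ≈ 0#
  monomial-zero zero    c≈0 zero    = c≈0
  monomial-zero zero    c≈0 (suc i) = refl
  monomial-zero (suc d) c≈0 zero    = refl
  monomial-zero (suc d) c≈0 (suc i) = monomial-zero d c≈0 i

  monomial-+ : ∀ d a b → monomial d a ⊕ monomial d b ≋ monomial d (a + b)
  monomial-+ zero    a b zero    = refl
  monomial-+ zero    a b (suc i) = +-identityˡ 0#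
  monomial-+ (suc d) a b zero    = +-identityˡ 0#
  monomial-+ (suc d) a b (suc i) = monomial-+ d a b i

  monomial-natural : (f : ℕ → Carrier → Carrier) → (∀ i → f i 0# ≈ 0#) →
                     ∀ d c i → f i (monomial d c i) ≈ monomial d (f d c) i
  monomial-natural f f0 zero    c zero    = refl
  monomial-natural f f0 zero    c (suc i) = f0 (suc i)
  monomial-natural f f0 (suc d) c zero    = f0 zero
  monomial-natural f f0 (suc d) c (suc i) =
    monomial-natural (λ j → f (suc j)) (λ j → f0 (suc j)) d c i

  *-monomial : ∀ y d a i → y * monomial d a i ≈ monomial d (y * a) i
  *-monomial y = monomial-natural (λ _ → y *_) (λ _ → zeroʳ y)

module PolynomialCoefficients {k kℓ m mℓ} {𝕜 : CommutativeRing k kℓ} (A : CommAlgebra 𝕜 m mℓ)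
       (∂ : CommAlgebra.Carrier A → CommAlgebra.Carrier A) (E₄ : CommAlgebra.Carrier A) where
  open CommAlgebra A hiding (zero)
  open Constructions A ∂ E₄
  open Sequences baseRing
  open NatMultiples baseRing using (·ℕ-zeroʳ)
  open import Algebra.Properties.Ring ring using (-0#≈0#)
  open import Algebra.Solver.Ring.NaturalCoefficients.Default commutativeSemiring
    using (solve; _:=_; _:+_; _:*_; con)
  open import Relation.Binary.Reasoning.Setoid setoid

  coeff : Poly → ℕ → Carrier
  coeff []      i       = 0#
  coeff (a ∷ p) zero    = a
  coeff (a ∷ p) (suc i) = coeff p i

  ≈ₚ-from-coeff : ∀ p q → coeff p ≋ coeff q → p ≈ₚ q
  ≈ₚ-from-coeff []      []      _ = _
  ≈ₚ-from-coeff []      (b ∷ q) e = sym (e zero) , ≈ₚ-from-coeff [] q (λ i → e (suc i))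
  ≈ₚ-from-coeff (a ∷ p) []      e = e zero , ≈ₚ-from-coeff p [] (λ i → e (suc i))
  ≈ₚ-from-coeff (a ∷ p) (b ∷ q) e = e zero , ≈ₚ-from-coeff p q (λ i → e (suc i))

  coeff-+ₚ : ∀ p q → coeff (p +ₚ q) ≋ coeff p ⊕ coeff q
  coeff-+ₚ []      q       i       = sym (+-identityˡ _)
  coeff-+ₚ (a ∷ p) []      i       = sym (+-identityʳ _)
  coeff-+ₚ (a ∷ p) (b ∷ q) zero    = refl
  coeff-+ₚ (a ∷ p) (b ∷ q) (suc i) = coeff-+ₚ p q i

  coeff-map : ∀ f → f 0# ≈ 0# → ∀ p i → coeff (map f p) i ≈ f (coeff p i)
  coeff-map f f0 []      i       = sym f0
  coeff-map f f0 (a ∷ p) zero    = refl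
  coeff-map f f0 (a ∷ p) (suc i) = coeff-map f f0 p i

  coeff-const : ∀ a → coeff (const a) ≋ monomial 0 a
  coeff-const a zero    = refl
  coeff-const a (suc i) = refl

  coeff-E₂ : coeff E₂ ≋ monomial 1 1#
  coeff-E₂ zero          = refl
  coeff-E₂ (suc zero)    = refl
  coeff-E₂ (suc (suc i)) = refl

  coeff-0∷ : ∀ p → coeff (0# ∷ p) ≋ shift (coeff p)
  coeff-0∷ p zero    = refl
  coeff-0∷ p (suc i) = refl

  coeff-*ₚ-cons : ∀ a p q i → coeff ((a ∷ p) *ₚ q) i ≈ a * coeff q i + shift (coeff (p *ₚ q)) i
  coeff-*ₚ-cons a p q i =
    trans (coeff-+ₚ (scaleₚ a q) (0# ∷ (p *ₚ q)) i)
          (+-cong (coeff-map (a *_) (zeroʳ a) q i) (coeff-0∷ (p *ₚ q) i))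

  coeff-const-*ₚ : ∀ a p i → coeff (const a *ₚ p) i ≈ a * coeff p i
  coeff-const-*ₚ a p zero    = trans (coeff-*ₚ-cons a [] p zero) (+-identityʳ _)
  coeff-const-*ₚ a p (suc i) = trans (coeff-*ₚ-cons a [] p (suc i)) (+-identityʳ _)

  coeff-E₂-*ₚ : ∀ p → coeff (E₂ *ₚ p) ≋ shift (coeff p)
  coeff-E₂-*ₚ p i = begin
    coeff (E₂ *ₚ p) i                                 ≈⟨ coeff-*ₚ-cons 0# (1# ∷ []) p i ⟩
    0# * coeff p i + shift (coeff (const 1# *ₚ p)) i  ≈⟨ +-cong (zeroˡ _) (shift-cong 1*p≋p i) ⟩
    0# + shift (coeff p) i                            ≈⟨ +-identityˡ _ ⟩
    shift (coeff p) i                                 ∎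
    where
    1*p≋p : coeff (const 1# *ₚ p) ≋ coeff p
    1*p≋p j = trans (coeff-const-*ₚ 1# p j) (*-identityˡ _)

  coeff-E₂^ : ∀ d → coeff (E₂ ^ₚ d) ≋ monomial d 1#
  coeff-E₂^ zero      = coeff-const 1#
  coeff-E₂^ (suc d) i = trans (coeff-E₂-*ₚ (E₂ ^ₚ d) i) (shift-cong (coeff-E₂^ d) i)

  coeff-const-*ₚ-E₂^ : ∀ c d → coeff (const c *ₚ (E₂ ^ₚ d)) ≋ monomial d c
  coeff-const-*ₚ-E₂^ c d i = begin
    coeff (const c *ₚ (E₂ ^ₚ d)) i  ≈⟨ coeff-const-*ₚ c (E₂ ^ₚ d) i ⟩
    c * coeff (E₂ ^ₚ d) i           ≈⟨ *-congˡ (coeff-E₂^ d i) ⟩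
    c * monomial d 1# i             ≈⟨ *-monomial c d 1# i ⟩
    monomial d (c * 1#) i           ≈⟨ monomial-cong d (*-identityʳ c) i ⟩
    monomial d c i                  ∎

  coeff-binomialₚ : ∀ a d c → coeff (const a +ₚ const c *ₚ (E₂ ^ₚ suc d)) ≋ binomial a d c
  coeff-binomialₚ a d c i =
    trans (coeff-+ₚ (const a) (const c *ₚ (E₂ ^ₚ suc d)) i)
          (+-cong (coeff-const a i) (coeff-const-*ₚ-E₂^ c (suc d) i))

  coeff-scaleₚ-binomial : ∀ y p a d c → coeff p ≋ binomial a d c →
                          coeff (scaleₚ y p) ≋ binomial (y * a) d (y * c)
  coeff-scaleₚ-binomial y p a d c p≋ i = begin
    coeff (scaleₚ y p) i                           ≈⟨ coeff-map (y *_) (zeroʳ y) p i ⟩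
    y * coeff p i                                  ≈⟨ *-congˡ (p≋ i) ⟩
    y * (monomial 0 a i + monomial (suc d) c i)    ≈⟨ distribˡ y _ _ ⟩
    y * monomial 0 a i + y * monomial (suc d) c i
      ≈⟨ +-cong (*-monomial y 0 a i) (*-monomial y (suc d) c i) ⟩
    monomial 0 (y * a) i + monomial (suc d) (y * c) i ∎

  coeff-const−E₂² : ∀ a →
    coeff (const a +ₚ (-ₚ (E₂ *ₚ E₂))) ≋ monomial 0 a ⊕ monomial 2 (- 1#)
  coeff-const−E₂² a i = begin
    coeff (const a +ₚ (-ₚ (E₂ *ₚ E₂))) i
      ≈⟨ coeff-+ₚ (const a) (-ₚ (E₂ *ₚ E₂)) i ⟩
    coeff (const a) i + coeff (-ₚ (E₂ *ₚ E₂)) i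
      ≈⟨ +-cong (coeff-const a i) (coeff-map -_ -0#≈0# (E₂ *ₚ E₂) i) ⟩
    monomial 0 a i + - coeff (E₂ *ₚ E₂) i
      ≈⟨ +-congˡ (-‿cong (trans (coeff-E₂-*ₚ E₂ i) (shift-cong coeff-E₂ i))) ⟩
    monomial 0 a i + - monomial 2 1# i
      ≈⟨ +-congˡ (monomial-natural (λ _ → -_) (λ _ → -0#≈0#) 2 1# i) ⟩
    monomial 0 a i + monomial 2 (- 1#) i
      ∎

  coeff-*ₚ-quadratic : ∀ {q x y} → coeff q ≋ monomial 0 x ⊕ monomial 2 y →
    ∀ p i → coeff (p *ₚ q) i ≈ coeff p i * x + shift (shift (coeff p)) i * y
  coeff-*ₚ-quadratic {q} {x} {y} q≋ = go
    where
    0≈0x+0y : 0# ≈ 0# * x + 0# * y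
    0≈0x+0y = solve 2 (λ x y → con 0 := con 0 :* x :+ con 0 :* y) refl x y

    go : ∀ p i → coeff (p *ₚ q) i ≈ coeff p i * x + shift (shift (coeff p)) i * y
    go []      zero                = 0≈0x+0y
    go []      (suc zero)          = 0≈0x+0y
    go []      (suc (suc i))       = 0≈0x+0y
    go (a ∷ p) zero                = begin
      coeff ((a ∷ p) *ₚ q) 0        ≈⟨ coeff-*ₚ-cons a p q 0 ⟩
      a * coeff q 0 + 0#            ≈⟨ +-congʳ (*-congˡ (q≋ 0)) ⟩
      a * (x + 0#) + 0#
        ≈⟨ solve 3 (λ a x y → a :* (x :+ con 0) :+ con 0 := a :* x :+ con 0 :* y) refl a x y ⟩
      a * x + 0# * y                ∎
    go (a ∷ p) (suc zero)          = begin
      coeff ((a ∷ p) *ₚ q) 1        ≈⟨ coeff-*ₚ-cons a p q 1 ⟩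
      a * coeff q 1 + coeff (p *ₚ q) 0
        ≈⟨ +-cong (*-congˡ (q≋ 1)) (go p 0) ⟩
      a * (0# + 0#) + (coeff p 0 * x + 0# * y)
        ≈⟨ solve 4 (λ a x y b → a :* (con 0 :+ con 0) :+ (b :* x :+ con 0 :* y) := b :* x :+ con 0 :* y)
                   refl a x y (coeff p 0) ⟩
      coeff p 0 * x + 0# * y        ∎
    go (a ∷ p) (suc (suc zero))    = begin
      coeff ((a ∷ p) *ₚ q) 2        ≈⟨ coeff-*ₚ-cons a p q 2 ⟩
      a * coeff q 2 + coeff (p *ₚ q) 1
        ≈⟨ +-cong (*-congˡ (q≋ 2)) (go p 1) ⟩
      a * (0# + y) + (coeff p 1 * x + 0# * y)
        ≈⟨ solve 4 (λ a x y b → a :* (con 0 :+ y) :+ (b :* x :+ con 0 :* y) := b :* x :+ a :* y)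
                   refl a x y (coeff p 1) ⟩
      coeff p 1 * x + a * y         ∎
    go (a ∷ p) (suc (suc (suc i))) = begin
      coeff ((a ∷ p) *ₚ q) (3 ℕ.+ i) ≈⟨ coeff-*ₚ-cons a p q (3 ℕ.+ i) ⟩
      a * coeff q (3 ℕ.+ i) + coeff (p *ₚ q) (2 ℕ.+ i)
        ≈⟨ +-cong (*-congˡ (q≋ (3 ℕ.+ i))) (go p (2 ℕ.+ i)) ⟩
      a * (0# + 0#) + (coeff p (2 ℕ.+ i) * x + coeff p i * y)
        ≈⟨ solve 5 (λ a x y b b′ → a :* (con 0 :+ con 0) :+ (b :* x :+ b′ :* y) := b :* x :+ b′ :* y)
                   refl a x y (coeff p (2 ℕ.+ i)) (coeff p i) ⟩
      coeff p (2 ℕ.+ i) * x + coeff p i * y ∎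

  coeff-derivFrom : ∀ j p i → coeff (derivFrom j p) i ≈ (j ℕ.+ i) ·ℕ coeff p i
  coeff-derivFrom j []      i       = sym (·ℕ-zeroʳ (j ℕ.+ i))
  coeff-derivFrom j (a ∷ p) zero    = reflexive (≡.cong (_·ℕ a) (≡.sym (ℕₚ.+-identityʳ j)))
  coeff-derivFrom j (a ∷ p) (suc i) =
    trans (coeff-derivFrom (suc j) p i) (reflexive (≡.cong (_·ℕ coeff p i) (≡.sym (ℕₚ.+-suc j i))))

  coeff-formalDeriv : ∀ p i → coeff (formalDeriv p) i ≈ suc i ·ℕ coeff p (suc i)
  coeff-formalDeriv []      i = sym (·ℕ-zeroʳ (suc i))
  coeff-formalDeriv (a ∷ p) i = coeff-derivFrom 1 p i

module DerivationConstants {k kℓ m mℓ h} {𝕜 : CommutativeRing k kℓ} {N : ℕ}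
       {A : CommAlgebra 𝕜 m mℓ} {G : Grading A h}
       {∂ : CommAlgebra.Carrier A → CommAlgebra.Carrier A} (D : IsDerivation2 N G ∂) where
  open CommAlgebra A hiding (zero)
  open IsDerivation2 D
  open import Algebra.Properties.Ring ring using (x+x≈x⇒x≈0; +-inverseˡ-unique; -0#≈0#)
  open import Relation.Binary.Reasoning.Setoid setoid

  ∂-0 : ∂ 0# ≈ 0#
  ∂-0 = x+x≈x⇒x≈0 (∂ 0#) (trans (sym (∂-+ 0# 0#)) (∂-cong (+-identityˡ 0#)))

  ∂-1 : ∂ 1# ≈ 0#
  ∂-1 = x+x≈x⇒x≈0 (∂ 1#) (begin
    ∂ 1# + ∂ 1#            ≈⟨ +-cong (*-identityʳ (∂ 1#)) (*-identityˡ (∂ 1#)) ⟨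
    ∂ 1# * 1# + 1# * ∂ 1#  ≈⟨ leibniz 1# 1# ⟨
    ∂ (1# * 1#)            ≈⟨ ∂-cong (*-identityˡ 1#) ⟩
    ∂ 1#                   ∎)

  ∂-neg : ∀ x → ∂ (- x) ≈ - ∂ x
  ∂-neg x = +-inverseˡ-unique (∂ (- x)) (∂ x) (begin
    ∂ (- x) + ∂ x  ≈⟨ ∂-+ (- x) x ⟨
    ∂ (- x + x)    ≈⟨ ∂-cong (-‿inverseˡ x) ⟩
    ∂ 0#           ≈⟨ ∂-0 ⟩
    0#             ∎)

  ∂-ι : ∀ c → ∂ (ι c) ≈ 0#
  ∂-ι c = begin
    ∂ (ι c)       ≈⟨ ∂-cong (*-identityʳ (ι c)) ⟨
    ∂ (c • 1#)    ≈⟨ ∂-• c 1# ⟩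
    ι c * ∂ 1#    ≈⟨ *-congˡ ∂-1 ⟩
    ι c * 0#      ≈⟨ zeroʳ (ι c) ⟩
    0#            ∎

  ∂-negPow : ∀ s → ∂ (negPow s) ≈ 0#
  ∂-negPow zero    = ∂-1
  ∂-negPow (suc s) = trans (∂-neg (negPow s)) (trans (-‿cong (∂-negPow s)) -0#≈0#)

  ∂-·ℕ1 : ∀ n → ∂ (n ·ℕ 1#) ≈ 0#
  ∂-·ℕ1 zero    = ∂-0
  ∂-·ℕ1 (suc n) = trans (∂-+ 1# (n ·ℕ 1#)) (trans (+-cong ∂-1 (∂-·ℕ1 n)) (+-identityʳ 0#))

  ∂-*-constants : ∀ {x y} → ∂ x ≈ 0# → ∂ y ≈ 0# → ∂ (x * y) ≈ 0#
  ∂-*-constants {x} {y} ∂x≈0 ∂y≈0 = begin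
    ∂ (x * y)          ≈⟨ leibniz x y ⟩
    ∂ x * y + x * ∂ y  ≈⟨ +-cong (*-congʳ ∂x≈0) (*-congˡ ∂y≈0) ⟩
    0# * y + x * 0#    ≈⟨ +-cong (zeroˡ y) (zeroʳ x) ⟩
    0# + 0#            ≈⟨ +-identityˡ 0# ⟩
    0#                 ∎

∂-degree-step : ∀ n N →
  (2 ℕ.* suc n ℕ.+ 2) ℕ.* N ℕ.+ 2 ℕ.* N ≡ (2 ℕ.* suc (suc n) ℕ.+ 2) ℕ.* N
∂-degree-step = solve-∀

E₄-degree-step : ∀ n N →
  4 ℕ.* N ℕ.+ (2 ℕ.* n ℕ.+ 2) ℕ.* N ≡ (2 ℕ.* suc (suc n) ℕ.+ 2) ℕ.* N
E₄-degree-step = solve-∀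

module Lemma6p1 {k kℓ m mℓ h} {𝕜 : CommutativeRing k kℓ} (N : ℕ)
       (A : CommAlgebra 𝕜 m mℓ) (G : Grading A h)
       (∂ : CommAlgebra.Carrier A → CommAlgebra.Carrier A) (D : IsDerivation2 N G ∂)
       (E₄ : CommAlgebra.Carrier A) where
  open CommAlgebra A hiding (zero)
  open Constructions A ∂ E₄
  open IsDerivation2 D
  open Grading G using (Hom; Hom-0; Hom-+; Hom-*)
  open Sequences baseRing
  open NatMultiples baseRing
  open PolynomialCoefficients A ∂ E₄
  open DerivationConstants D
  open import Algebra.Properties.Ring ring using (-‿distribˡ-*; -‿distribʳ-*; -0#≈0#)
  open import Algebra.Properties.CommutativeSemigroup *-commutativeSemigroup using (x∙yz≈y∙xz)
  open import Algebra.Solver.Ring.NaturalCoefficients.Default commutativeSemiring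
    using (solve; _:=_; _:+_; _:*_)
  open import Relation.Binary.Reasoning.Setoid setoid

  ∂-signFact : ∀ s n → ∂ (signFact s n) ≈ 0#
  ∂-signFact s n = ∂-*-constants (∂-negPow s) (∂-·ℕ1 (n !))

  signFact-zero : signFact 0 0 ≈ 1#
  signFact-zero = trans (*-identityˡ _) (+-identityʳ 1#)

  signFact-flip : ∀ s n → signFact (suc s) n ≈ - signFact s n
  signFact-flip s n = sym (-‿distribˡ-* (negPow s) ((n !) ·ℕ 1#))

  signFact-suc : ∀ n → signFact (suc n) (suc n) ≈ - (suc n ·ℕ signFact n n)
  signFact-suc n = begin
    - ν * ((suc n ℕ.* n !) ·ℕ 1#)  ≈⟨ *-congˡ (·ℕ1-homo-* (suc n) (n !)) ⟩
    - ν * (n+1 * n!)               ≈⟨ -‿distribˡ-* ν (n+1 * n!) ⟨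
    - (ν * (n+1 * n!))             ≈⟨ -‿cong (x∙yz≈y∙xz ν n+1 n!) ⟩
    - (n+1 * (ν * n!))             ≈⟨ -‿cong (·ℕ-as-* (suc n) (ν * n!)) ⟨
    - (suc n ·ℕ (ν * n!))          ∎
    where
    ν   = negPow n
    n!  = (n !) ·ℕ 1#
    n+1 = suc n ·ℕ 1#

  E₄-coefficients-cancel : ∀ n →
    (suc (suc n) ·ℕ signFact (suc n) (suc n)) * E₄
      + ((suc n ℕ.* suc (suc n)) ·ℕ E₄) * signFact n n ≈ 0#
  E₄-coefficients-cancel n = begin
    (suc (suc n) ·ℕ c₁) * E₄ + ((suc n ℕ.* suc (suc n)) ·ℕ E₄) * c₀
      ≈⟨ +-cong (*-congʳ (·ℕ-as-* (suc (suc n)) c₁)) (*-congʳ wE₄≈) ⟩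
    (n+2 * c₁) * E₄ + ((n+1 * n+2) * E₄) * c₀
      ≈⟨ solve 5 (λ a b x y e → (b :* x) :* e :+ ((a :* b) :* e) :* y := (b :* e) :* (x :+ a :* y))
                 refl n+1 n+2 c₁ c₀ E₄ ⟩
    (n+2 * E₄) * (c₁ + n+1 * c₀)
      ≈⟨ *-congˡ (+-cong (signFact-suc n) (sym (·ℕ-as-* (suc n) c₀))) ⟩
    (n+2 * E₄) * (- (suc n ·ℕ c₀) + suc n ·ℕ c₀)
      ≈⟨ *-congˡ (-‿inverseˡ _) ⟩
    (n+2 * E₄) * 0#
      ≈⟨ zeroʳ _ ⟩
    0# ∎
    where
    c₀  = signFact n n
    c₁  = signFact (suc n) (suc n)
    n+1 = suc n ·ℕ 1#
    n+2 = suc (suc n) ·ℕ 1#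

    wE₄≈ : (suc n ℕ.* suc (suc n)) ·ℕ E₄ ≈ (n+1 * n+2) * E₄
    wE₄≈ = trans (·ℕ-as-* (suc n ℕ.* suc (suc n)) E₄) (*-congʳ (·ℕ1-homo-* (suc n) (suc (suc n))))

  coeff-∂̃-binomial : ∀ p a d c → ∂ c ≈ 0# → coeff p ≋ binomial a d c →
    coeff (∂̃ p) ≋ monomial 0 (∂ a) ⊕ monomial d ((suc d ·ℕ c) * E₄)
                    ⊕ monomial (2 ℕ.+ d) (- (suc d ·ℕ c))
  coeff-∂̃-binomial p a d c ∂c≈0 p≋ i = begin
    coeff (∂̃ p) i
      ≈⟨ coeff-+ₚ (map ∂ p) (formalDeriv p *ₚ (const E₄ +ₚ (-ₚ (E₂ *ₚ E₂)))) i ⟩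
    coeff (map ∂ p) i + coeff (formalDeriv p *ₚ (const E₄ +ₚ (-ₚ (E₂ *ₚ E₂)))) i
      ≈⟨ +-cong (coeff-map ∂ ∂-0 p i)
                (coeff-*ₚ-quadratic (coeff-const−E₂² E₄) (formalDeriv p) i) ⟩
    ∂ (coeff p i) + (coeff p′ i * E₄ + shift (shift (coeff p′)) i * - 1#)
      ≈⟨ +-cong ∂-part (+-cong (*-congʳ (p′≋ i)) (*-congʳ (shift-cong (shift-cong p′≋) i))) ⟩
    monomial 0 (∂ a) i + (monomial d z i * E₄ + monomial (2 ℕ.+ d) z i * - 1#)
      ≈⟨ +-congˡ (+-cong (monomial-natural (λ _ → _* E₄) (λ _ → zeroˡ E₄) d z i)
                         (trans (x*-1≈-x _)
                                (monomial-natural (λ _ → -_) (λ _ → -0#≈0#) (2 ℕ.+ d) z i))) ⟩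
    monomial 0 (∂ a) i + (monomial d (z * E₄) i + monomial (2 ℕ.+ d) (- z) i)
      ≈⟨ +-assoc _ _ _ ⟨
    monomial 0 (∂ a) i + monomial d (z * E₄) i + monomial (2 ℕ.+ d) (- z) i ∎
    where
    p′ = formalDeriv p
    z  = suc d ·ℕ c

    x*-1≈-x : ∀ x → x * - 1# ≈ - x
    x*-1≈-x x = trans (sym (-‿distribʳ-* x 1#)) (-‿cong (*-identityʳ x))

    p′≋ : coeff p′ ≋ monomial d z
    p′≋ j = begin
      coeff p′ j                ≈⟨ coeff-formalDeriv p j ⟩
      suc j ·ℕ coeff p (suc j)  ≈⟨ ·ℕ-congʳ (suc j) (trans (p≋ (suc j)) (+-identityˡ _)) ⟩
      suc j ·ℕ monomial d c j
        ≈⟨ monomial-natural (λ j → suc j ·ℕ_) (λ j → ·ℕ-zeroʳ (suc j)) d c j ⟩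
      monomial d z j            ∎

    ∂-part : ∂ (coeff p i) ≈ monomial 0 (∂ a) i
    ∂-part = begin
      ∂ (coeff p i)                                  ≈⟨ ∂-cong (p≋ i) ⟩
      ∂ (monomial 0 a i + monomial (suc d) c i)      ≈⟨ ∂-+ _ _ ⟩
      ∂ (monomial 0 a i) + ∂ (monomial (suc d) c i)
        ≈⟨ +-cong (∂-monomial 0 a) (∂-monomial (suc d) c) ⟩
      monomial 0 (∂ a) i + monomial (suc d) (∂ c) i  ≈⟨ +-congˡ (monomial-zero (suc d) ∂c≈0 i) ⟩
      monomial 0 (∂ a) i + 0#                        ≈⟨ +-identityʳ _ ⟩
      monomial 0 (∂ a) i                             ∎
      where
      ∂-monomial : ∀ e b → ∂ (monomial e b i) ≈ monomial e (∂ b) i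
      ∂-monomial e b = monomial-natural (λ _ → ∂) (λ _ → ∂-0) e b i

  ∂₍₎E₂-binomial : ∀ n → coeff ∂₍ n ₎E₂ ≋ binomial (Ψ n) n (signFact n n)
  ∂₍₎E₂-binomial zero i = begin
    coeff E₂ i                                     ≈⟨ coeff-E₂ i ⟩
    monomial 1 1# i                                ≈⟨ monomial-cong 1 signFact-zero i ⟨
    monomial 1 (signFact 0 0) i                    ≈⟨ +-identityˡ _ ⟨
    0# + monomial 1 (signFact 0 0) i               ≈⟨ +-congʳ (monomial-zero 0 refl i) ⟨
    monomial 0 0# i + monomial 1 (signFact 0 0) i  ∎
  ∂₍₎E₂-binomial (suc zero) i = begin
    coeff (∂̃ E₂) i
      ≈⟨ coeff-∂̃-binomial E₂ _ 0 _ (∂-signFact 0 0) (∂₍₎E₂-binomial 0) i ⟩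
    monomial 0 (∂ 0#) i + monomial 0 ((1 ·ℕ c₀) * E₄) i + monomial 2 (- (1 ·ℕ c₀)) i
      ≈⟨ +-cong (+-cong (monomial-zero 0 ∂-0 i) (monomial-cong 0 c₀E₄≈E₄ i))
                (monomial-cong 2 (sym (signFact-suc 0)) i) ⟩
    0# + monomial 0 E₄ i + monomial 2 (signFact 1 1) i
      ≈⟨ +-congʳ (+-identityˡ _) ⟩
    monomial 0 E₄ i + monomial 2 (signFact 1 1) i
      ∎
    where
    c₀ = signFact 0 0
    c₀E₄≈E₄ : (1 ·ℕ c₀) * E₄ ≈ E₄
    c₀E₄≈E₄ = trans (*-congʳ (trans (+-identityʳ c₀) signFact-zero)) (*-identityˡ E₄)
  ∂₍₎E₂-binomial (suc (suc n)) i = begin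
    coeff (∂̃ ∂₍ suc n ₎E₂ +ₚ scaleₚ wE₄ ∂₍ n ₎E₂) i
      ≈⟨ coeff-+ₚ (∂̃ ∂₍ suc n ₎E₂) (scaleₚ wE₄ ∂₍ n ₎E₂) i ⟩
    coeff (∂̃ ∂₍ suc n ₎E₂) i + coeff (scaleₚ wE₄ ∂₍ n ₎E₂) i
      ≈⟨ +-cong (coeff-∂̃-binomial ∂₍ suc n ₎E₂ _ (suc n) _
                   (∂-signFact (suc n) (suc n)) (∂₍₎E₂-binomial (suc n)) i)
                (coeff-scaleₚ-binomial wE₄ ∂₍ n ₎E₂ _ n _ (∂₍₎E₂-binomial n) i) ⟩
    (monomial 0 (∂ Ψ₁) i + monomial (suc n) (X * E₄) i + monomial (3 ℕ.+ n) (- X) i)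
      + (monomial 0 (wE₄ * Ψ₀) i + monomial (suc n) (wE₄ * c₀) i)
      ≈⟨ solve 5 (λ u v x y z → u :+ v :+ x :+ (y :+ z) := u :+ y :+ (v :+ z :+ x)) refl _ _ _ _ _ ⟩
    (monomial 0 (∂ Ψ₁) i + monomial 0 (wE₄ * Ψ₀) i)
      + (monomial (suc n) (X * E₄) i + monomial (suc n) (wE₄ * c₀) i + monomial (3 ℕ.+ n) (- X) i)
      ≈⟨ +-cong (monomial-+ 0 _ _ i) (+-congʳ (monomial-+ (suc n) _ _ i)) ⟩
    monomial 0 (∂ Ψ₁ + wE₄ * Ψ₀) i
      + (monomial (suc n) (X * E₄ + wE₄ * c₀) i + monomial (3 ℕ.+ n) (- X) i)
      ≈⟨ +-cong (monomial-cong 0 (+-congˡ (·ℕ-assoc-* w E₄ Ψ₀)) i)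
                (+-cong (monomial-zero (suc n) (E₄-coefficients-cancel n) i)
                        (monomial-cong (3 ℕ.+ n) (sym (signFact-suc (suc n))) i)) ⟩
    monomial 0 (Ψ (suc (suc n))) i + (0# + monomial (3 ℕ.+ n) c₂ i)
      ≈⟨ +-congˡ (+-identityˡ _) ⟩
    monomial 0 (Ψ (suc (suc n))) i + monomial (3 ℕ.+ n) c₂ i
      ∎
    where
    w   = suc n ℕ.* suc (suc n)
    wE₄ = w ·ℕ E₄
    Ψ₀  = Ψ n
    Ψ₁  = Ψ (suc n)
    c₀  = signFact n n
    X   = suc (suc n) ·ℕ signFact (suc n) (suc n)
    c₂  = signFact (suc (suc n)) (suc (suc n))

  ∂₍₎E₂-closed-form : ∀ n → ∂₍ n ₎E₂ ≈ₚ const (Ψ n) +ₚ const (signFact n n) *ₚ (E₂ ^ₚ suc n)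
  ∂₍₎E₂-closed-form n = ≈ₚ-from-coeff _ _ λ i →
    trans (∂₍₎E₂-binomial n i) (sym (coeff-binomialₚ (Ψ n) n (signFact n n) i))

  Ψ-closed-form : ∀ n → const (Ψ n) ≈ₚ ∂₍ n ₎E₂ +ₚ const (signFact (suc n) n) *ₚ (E₂ ^ₚ suc n)
  Ψ-closed-form n = ≈ₚ-from-coeff _ _ λ i → sym (begin
    coeff (∂₍ n ₎E₂ +ₚ const c′ *ₚ (E₂ ^ₚ suc n)) i
      ≈⟨ coeff-+ₚ ∂₍ n ₎E₂ (const c′ *ₚ (E₂ ^ₚ suc n)) i ⟩
    coeff ∂₍ n ₎E₂ i + coeff (const c′ *ₚ (E₂ ^ₚ suc n)) i
      ≈⟨ +-cong (∂₍₎E₂-binomial n i) (coeff-const-*ₚ-E₂^ c′ (suc n) i) ⟩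
    monomial 0 (Ψ n) i + monomial (suc n) c i + monomial (suc n) c′ i
      ≈⟨ +-assoc _ _ _ ⟩
    monomial 0 (Ψ n) i + (monomial (suc n) c i + monomial (suc n) c′ i)
      ≈⟨ +-congˡ (monomial-+ (suc n) c c′ i) ⟩
    monomial 0 (Ψ n) i + monomial (suc n) (c + c′) i
      ≈⟨ +-congˡ (monomial-zero (suc n) c+c′≈0 i) ⟩
    monomial 0 (Ψ n) i + 0#
      ≈⟨ +-identityʳ _ ⟩
    monomial 0 (Ψ n) i
      ≈⟨ coeff-const (Ψ n) i ⟨
    coeff (const (Ψ n)) i ∎)
    where
    c  = signFact n n
    c′ = signFact (suc n) n
    c+c′≈0 : c + c′ ≈ 0#
    c+c′≈0 = trans (+-congˡ (signFact-flip n n)) (-‿inverseʳ c)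

  ∂^-∈-E₄-derivs : ∀ {j n} → j < n → ∂^ j E₄ ∈ E₄-derivs n
  ∂^-∈-E₄-derivs j<n = ∈-map⁺ ∂^_E₄ (∈-upTo⁺ j<n)

  E₄-derivs-⊆-suc : ∀ {n} → E₄-derivs n ⊆ E₄-derivs (suc n)
  E₄-derivs-⊆-suc x∈ with ∈-map⁻ ∂^_E₄ x∈
  ... | j , j∈ , ≡.refl = ∂^-∈-E₄-derivs (ℕₚ.m<n⇒m<1+n (∈-upTo⁻ j∈))

  ∂-∈-E₄-derivs : ∀ {n x} → x ∈ E₄-derivs n → ∂ x ∈ E₄-derivs (suc n)
  ∂-∈-E₄-derivs x∈ with ∈-map⁻ ∂^_E₄ x∈
  ... | j , j∈ , ≡.refl = ∂^-∈-E₄-derivs (s≤s (∈-upTo⁻ j∈))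

  PolyIn-⊆ : ∀ {gs hs x} → gs ⊆ hs → PolyIn gs x → PolyIn hs x
  PolyIn-⊆ gs⊆hs (scalar c) = scalar c
  PolyIn-⊆ gs⊆hs (gen x∈)   = gen (gs⊆hs x∈)
  PolyIn-⊆ gs⊆hs (add p q)  = add (PolyIn-⊆ gs⊆hs p) (PolyIn-⊆ gs⊆hs q)
  PolyIn-⊆ gs⊆hs (mul p q)  = mul (PolyIn-⊆ gs⊆hs p) (PolyIn-⊆ gs⊆hs q)
  PolyIn-⊆ gs⊆hs (resp e p) = resp e (PolyIn-⊆ gs⊆hs p)

  PolyIn-0 : ∀ {gs} → PolyIn gs 0#
  PolyIn-0 = resp (RingMorphisms.IsRingHomomorphism.0#-homo ι-hom) (scalar _)

  PolyIn-·ℕ : ∀ {gs x} n → PolyIn gs x → PolyIn gs (n ·ℕ x)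
  PolyIn-·ℕ zero    p = PolyIn-0
  PolyIn-·ℕ (suc n) p = add p (PolyIn-·ℕ n p)

  PolyIn-∂ : ∀ {n x} → PolyIn (E₄-derivs n) x → PolyIn (E₄-derivs (suc n)) (∂ x)
  PolyIn-∂ (scalar c) = resp (sym (∂-ι c)) PolyIn-0
  PolyIn-∂ (gen x∈)   = gen (∂-∈-E₄-derivs x∈)
  PolyIn-∂ (add p q)  = resp (sym (∂-+ _ _)) (add (PolyIn-∂ p) (PolyIn-∂ q))
  PolyIn-∂ (mul p q)  = resp (sym (leibniz _ _))
    (add (mul (PolyIn-∂ p) (PolyIn-⊆ E₄-derivs-⊆-suc q))
         (mul (PolyIn-⊆ E₄-derivs-⊆-suc p) (PolyIn-∂ q)))
  PolyIn-∂ (resp e p) = resp (∂-cong e) (PolyIn-∂ p)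

  Ψ-PolyIn : ∀ n → PolyIn (E₄-derivs n) (Ψ n)
  Ψ-PolyIn zero          = PolyIn-0
  Ψ-PolyIn (suc zero)    = gen (∂^-∈-E₄-derivs (s≤s z≤n))
  Ψ-PolyIn (suc (suc n)) = add (PolyIn-∂ (Ψ-PolyIn (suc n)))
    (PolyIn-·ℕ (suc n ℕ.* suc (suc n))
      (mul (gen (∂^-∈-E₄-derivs (s≤s z≤n)))
           (PolyIn-⊆ E₄-derivs-⊆-suc (PolyIn-⊆ E₄-derivs-⊆-suc (Ψ-PolyIn n)))))

  Hom-·ℕ : ∀ {i x} n → Hom i x → Hom i (n ·ℕ x)
  Hom-·ℕ zero    x-hom = Hom-0
  Hom-·ℕ (suc n) x-hom = Hom-+ x-hom (Hom-·ℕ n x-hom)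

  Ψ-Hom : Hom (ℤ.+ (4 ℕ.* N)) E₄ → ∀ n → Hom (ℤ.+ ((2 ℕ.* n ℕ.+ 2) ℕ.* N)) (Ψ n)
  Ψ-Hom E₄-hom zero          = Hom-0
  Ψ-Hom E₄-hom (suc zero)    = E₄-hom
  Ψ-Hom E₄-hom (suc (suc n)) = Hom-+
    (≡.subst (λ j → Hom (ℤ.+ j) (∂ (Ψ (suc n)))) (∂-degree-step n N)
       (∂-degree (Ψ-Hom E₄-hom (suc n))))
    (Hom-·ℕ (suc n ℕ.* suc (suc n))
      (≡.subst (λ j → Hom (ℤ.+ j) (E₄ * Ψ n)) (E₄-degree-step n N)
         (Hom-* E₄-hom (Ψ-Hom E₄-hom n))))

lemma6p1 : ∀ {k kℓ m mℓ h} (𝕜 : CommutativeRing k kℓ) → IsField 𝕜 → CharZero 𝕜 →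
    (N : ℕ) → 0 < N →
    (A : CommAlgebra 𝕜 m mℓ) (G : Grading A h) →
    (∂ : CommAlgebra.Carrier A → CommAlgebra.Carrier A) → IsDerivation2 N G ∂ →
    (E₄ : CommAlgebra.Carrier A) → Grading.Hom G (ℤ.+ (4 ℕ.* N)) E₄ →
    let open CommAlgebra A
        open Constructions A ∂ E₄
    in ∀ (n : ℕ) →
      PolyIn (E₄-derivs n) (Ψ n)
      × (∂₍ n ₎E₂ ≈ₚ const (Ψ n) +ₚ const (signFact n n) *ₚ (E₂ ^ₚ suc n))
      × (const (Ψ n) ≈ₚ ∂₍ n ₎E₂ +ₚ const (signFact (suc n) n) *ₚ (E₂ ^ₚ suc n))
      × Grading.Hom G (ℤ.+ ((2 ℕ.* n ℕ.+ 2) ℕ.* N)) (Ψ n)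
-- The field, characteristic-zero and N > 0 hypotheses are unused: the argument works over any
-- commutative ring.
lemma6p1 𝕜 _ _ N _ A G ∂ D E₄ E₄-hom n =
  Ψ-PolyIn n , ∂₍₎E₂-closed-form n , Ψ-closed-form n , Ψ-Hom E₄-hom n
  where open Lemma6p1 N A G ∂ D E₄
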